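{- Let $R$ be a set of $8$ pairwise orthogonal positive roots of $\Phi$ (type $E_8$) with $\theta\notin R$. Suppose $H\in D_4(R)$ or $H\in D_6(R)$, and let $\Xi=\mathrm{Span}(H)\cap\Phi$. (i) $\mathrm{Res}^2(R)=\{\theta\}$ and $\theta\in\mathrm{Res}_{\Phi_+}(H)$. (ii) If $|H\cap U_0|<4$, then $\mathrm{Res}^0(H)=\emptyset$. (iii) If $|H\cap U_1|<4$, then $\theta\notin\Xi$ and $\mathrm{Res}^2(H)=\emptyset$.
   Context: $\Phi$ is the root system of type $E_8$ with simple roots $\alpha_1,\dots,\alpha_8$ labelled so that $\alpha_1,\alpha_3,\alpha_4,\dots,\alpha_8$ form a path in this order and $\alpha_2$ is joined only to $\alpha_4$; invariant form $B$; $s_\beta(\gamma)=\gamma-B(\beta,\gamma)\beta$. The $8$-height of a root is its $\alpha_8$-coefficient; $U_i$ is the set of positive roots of $8$-height $i$; $\theta=2\alpha_1+3\alpha_2+4\alpha_3+6\alpha_4+5\alpha_5+4\alpha_6+3\alpha_7+2\alpha_8$ is the highest root. For a set $X$ of roots and $U\subseteq\Phi_+$, $\mathrm{Res}_U(X)=\{\gamma\in U:s_\beta(\gamma)\in\Phi_+\ \forall\beta\in X\}$; for $X$ pairwise orthogonal positive, $\mathrm{Res}(X)=\mathrm{Res}_{\mathrm{Span}(X)\cap\Phi_+}(X)$ and $\mathrm{Res}^i(X)=\mathrm{Res}(X)\cap U_i$. $D_k(R)=\{H\subseteq R:|H|=k,\ \mathrm{Span}(H)\cap\Phi\text{ is a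 subsystem of type }D_k\}$. -}

module Defs where

open import Data.Nat as ℕ using (ℕ; zero; suc)
open import Data.Integer as ℤ using (ℤ; +_; _+_; _-_; _*_; -_)
open import Data.Fin using (Fin)
open import Data.Vec as Vec using (Vec; []; _∷_)
open import Data.Vec.Properties using (≡-dec)
open import Data.List as List using (List; length; filter; lookup)
open import Data.List.Membership.Propositional using (_∈_)
open import Data.List.Relation.Unary.All using (All)
open import Data.List.Relation.Unary.AllPairs using (AllPairs)
open import Data.List.Relation.Unary.Unique.Propositional using (Unique)
open import Data.Product using (Σ; _×_; proj₁)
open import Data.Sum using (_⊎_)
open import Relation.Binary.PropositionalEquality using (_≡_)
open import Relation.Binary.Definitions using (DecidableEquality)
open import Relation.Nullary using (¬_)
open import Relation.Nullary.Decidable using (_×-dec_)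
open import Relation.Unary using (Decidable)

-- Roots are written in the basis of simple roots α₁ … α₈ (Bourbaki
-- labelling: α₁-α₃-α₄-α₅-α₆-α₇-α₈ a path, α₂ joined to α₄).

Root : Set
Root = Vec ℤ 8

_≟R_ : DecidableEquality Root
_≟R_ = ≡-dec ℤ._≟_

-- The invariant form B, given by the (symmetric) Cartan matrix of E₈:
-- B(αᵢ,αᵢ) = 2, B(αᵢ,αⱼ) = -1 for adjacent nodes, 0 otherwise.
B : Root → Root → ℤ
B (a1 ∷ a2 ∷ a3 ∷ a4 ∷ a5 ∷ a6 ∷ a7 ∷ a8 ∷ [])
  (b1 ∷ b2 ∷ b3 ∷ b4 ∷ b5 ∷ b6 ∷ b7 ∷ b8 ∷ []) =
  + 2 * (a1 * b1 + a2 * b2 + a3 * b3 + a4 * b4 + a5 * b5 + a6 * b6 + a7 * b7 + a8 * b8)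
  - (a1 * b3 + a3 * b1)
  - (a3 * b4 + a4 * b3)
  - (a4 * b5 + a5 * b4)
  - (a5 * b6 + a6 * b5)
  - (a6 * b7 + a7 * b6)
  - (a7 * b8 + a8 * b7)
  - (a2 * b4 + a4 * b2)

_·ᵥ_ : ℤ → Root → Root
c ·ᵥ v = Vec.map (c *_) v

_+ᵥ_ : Root → Root → Root
_+ᵥ_ = Vec.zipWith _+_

_-ᵥ_ : Root → Root → Root
_-ᵥ_ = Vec.zipWith _-_

negᵥ : Root → Root
negᵥ = Vec.map (λ x → - x)

zeroᵥ : Root
zeroᵥ = Vec.replicate 8 (+ 0)

s : Root → Root → Root
s β γ = γ -ᵥ (B β γ ·ᵥ β)

r : ℕ → ℕ → ℕ → ℕ → ℕ → ℕ → ℕ → ℕ → Root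
r a b c d e f g h = Vec.map +_ (a ∷ b ∷ c ∷ d ∷ e ∷ f ∷ g ∷ h ∷ [])

-- The 120 positive roots of E₈ (coefficients w.r.t. α₁ … α₈); these are
-- exactly the nonzero vectors with nonnegative integer coefficients
-- and B(v,v) = 2.
positiveRoots : List Root
positiveRoots =
  r 0 0 0 0 0 0 0 1
  List.∷ r 0 0 0 0 0 0 1 0
  List.∷ r 0 0 0 0 0 0 1 1
  List.∷ r 0 0 0 0 0 1 0 0
  List.∷ r 0 0 0 0 0 1 1 0
  List.∷ r 0 0 0 0 0 1 1 1
  List.∷ r 0 0 0 0 1 0 0 0
  List.∷ r 0 0 0 0 1 1 0 0
  List.∷ r 0 0 0 0 1 1 1 0
  List.∷ r 0 0 0 0 1 1 1 1
  List.∷ r 0 0 0 1 0 0 0 0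
  List.∷ r 0 0 0 1 1 0 0 0
  List.∷ r 0 0 0 1 1 1 0 0
  List.∷ r 0 0 0 1 1 1 1 0
  List.∷ r 0 0 0 1 1 1 1 1
  List.∷ r 0 0 1 0 0 0 0 0
  List.∷ r 0 0 1 1 0 0 0 0
  List.∷ r 0 0 1 1 1 0 0 0
  List.∷ r 0 0 1 1 1 1 0 0
  List.∷ r 0 0 1 1 1 1 1 0
  List.∷ r 0 0 1 1 1 1 1 1
  List.∷ r 0 1 0 0 0 0 0 0
  List.∷ r 0 1 0 1 0 0 0 0
  List.∷ r 0 1 0 1 1 0 0 0
  List.∷ r 0 1 0 1 1 1 0 0
  List.∷ r 0 1 0 1 1 1 1 0
  List.∷ r 0 1 0 1 1 1 1 1
  List.∷ r 0 1 1 1 0 0 0 0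
  List.∷ r 0 1 1 1 1 0 0 0
  List.∷ r 0 1 1 1 1 1 0 0
  List.∷ r 0 1 1 1 1 1 1 0
  List.∷ r 0 1 1 1 1 1 1 1
  List.∷ r 0 1 1 2 1 0 0 0
  List.∷ r 0 1 1 2 1 1 0 0
  List.∷ r 0 1 1 2 1 1 1 0
  List.∷ r 0 1 1 2 1 1 1 1
  List.∷ r 0 1 1 2 2 1 0 0
  List.∷ r 0 1 1 2 2 1 1 0
  List.∷ r 0 1 1 2 2 1 1 1
  List.∷ r 0 1 1 2 2 2 1 0
  List.∷ r 0 1 1 2 2 2 1 1
  List.∷ r 0 1 1 2 2 2 2 1
  List.∷ r 1 0 0 0 0 0 0 0
  List.∷ r 1 0 1 0 0 0 0 0
  List.∷ r 1 0 1 1 0 0 0 0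
  List.∷ r 1 0 1 1 1 0 0 0
  List.∷ r 1 0 1 1 1 1 0 0
  List.∷ r 1 0 1 1 1 1 1 0
  List.∷ r 1 0 1 1 1 1 1 1
  List.∷ r 1 1 1 1 0 0 0 0
  List.∷ r 1 1 1 1 1 0 0 0
  List.∷ r 1 1 1 1 1 1 0 0
  List.∷ r 1 1 1 1 1 1 1 0
  List.∷ r 1 1 1 1 1 1 1 1
  List.∷ r 1 1 1 2 1 0 0 0
  List.∷ r 1 1 1 2 1 1 0 0
  List.∷ r 1 1 1 2 1 1 1 0
  List.∷ r 1 1 1 2 1 1 1 1
  List.∷ r 1 1 1 2 2 1 0 0
  List.∷ r 1 1 1 2 2 1 1 0
  List.∷ r 1 1 1 2 2 1 1 1
  List.∷ r 1 1 1 2 2 2 1 0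
  List.∷ r 1 1 1 2 2 2 1 1
  List.∷ r 1 1 1 2 2 2 2 1
  List.∷ r 1 1 2 2 1 0 0 0
  List.∷ r 1 1 2 2 1 1 0 0
  List.∷ r 1 1 2 2 1 1 1 0
  List.∷ r 1 1 2 2 1 1 1 1
  List.∷ r 1 1 2 2 2 1 0 0
  List.∷ r 1 1 2 2 2 1 1 0
  List.∷ r 1 1 2 2 2 1 1 1
  List.∷ r 1 1 2 2 2 2 1 0
  List.∷ r 1 1 2 2 2 2 1 1
  List.∷ r 1 1 2 2 2 2 2 1
  List.∷ r 1 1 2 3 2 1 0 0
  List.∷ r 1 1 2 3 2 1 1 0
  List.∷ r 1 1 2 3 2 1 1 1
  List.∷ r 1 1 2 3 2 2 1 0
  List.∷ r 1 1 2 3 2 2 1 1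
  List.∷ r 1 1 2 3 2 2 2 1
  List.∷ r 1 1 2 3 3 2 1 0
  List.∷ r 1 1 2 3 3 2 1 1
  List.∷ r 1 1 2 3 3 2 2 1
  List.∷ r 1 1 2 3 3 3 2 1
  List.∷ r 1 2 2 3 2 1 0 0
  List.∷ r 1 2 2 3 2 1 1 0
  List.∷ r 1 2 2 3 2 1 1 1
  List.∷ r 1 2 2 3 2 2 1 0
  List.∷ r 1 2 2 3 2 2 1 1
  List.∷ r 1 2 2 3 2 2 2 1
  List.∷ r 1 2 2 3 3 2 1 0
  List.∷ r 1 2 2 3 3 2 1 1
  List.∷ r 1 2 2 3 3 2 2 1
  List.∷ r 1 2 2 3 3 3 2 1
  List.∷ r 1 2 2 4 3 2 1 0
  List.∷ r 1 2 2 4 3 2 1 1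
  List.∷ r 1 2 2 4 3 2 2 1
  List.∷ r 1 2 2 4 3 3 2 1
  List.∷ r 1 2 2 4 4 3 2 1
  List.∷ r 1 2 3 4 3 2 1 0
  List.∷ r 1 2 3 4 3 2 1 1
  List.∷ r 1 2 3 4 3 2 2 1
  List.∷ r 1 2 3 4 3 3 2 1
  List.∷ r 1 2 3 4 4 3 2 1
  List.∷ r 1 2 3 5 4 3 2 1
  List.∷ r 1 3 3 5 4 3 2 1
  List.∷ r 2 2 3 4 3 2 1 0
  List.∷ r 2 2 3 4 3 2 1 1
  List.∷ r 2 2 3 4 3 2 2 1
  List.∷ r 2 2 3 4 3 3 2 1
  List.∷ r 2 2 3 4 4 3 2 1
  List.∷ r 2 2 3 5 4 3 2 1
  List.∷ r 2 2 4 5 4 3 2 1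
  List.∷ r 2 3 3 5 4 3 2 1
  List.∷ r 2 3 4 5 4 3 2 1
  List.∷ r 2 3 4 6 4 3 2 1
  List.∷ r 2 3 4 6 5 3 2 1
  List.∷ r 2 3 4 6 5 4 2 1
  List.∷ r 2 3 4 6 5 4 3 1
  List.∷ r 2 3 4 6 5 4 3 2
  List.∷ List.[]

_∈Φ₊ : Root → Set
γ ∈Φ₊ = γ ∈ positiveRoots

_∈Φ : Root → Set
γ ∈Φ = γ ∈Φ₊ ⊎ negᵥ γ ∈Φ₊

θ : Root
θ = r 2 3 4 6 5 4 3 2

height8 : Root → ℤ
height8 = Vec.last

U : ℕ → Root → Set
U i γ = γ ∈Φ₊ × height8 γ ≡ + i

-- Span(X) (rational span) : γ ∈ Span X iff some positive integer
-- multiple of γ is an integer combination of elements of X.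
linComb : (X : List Root) → (Fin (length X) → ℤ) → Root
linComb List.[] c = zeroᵥ
linComb (x List.∷ X) c = (c Fin.zero ·ᵥ x) +ᵥ linComb X (λ i → c (Fin.suc i))
  where import Data.Fin as Fin

InSpan : List Root → Root → Set
InSpan X γ = Σ ℕ λ d → Σ (Fin (length X) → ℤ) λ c →
  (+ suc d) ·ᵥ γ ≡ linComb X c

Res_on_ : (Root → Set) → List Root → Root → Set
(Res U' on X) γ = U' γ × (∀ β → β ∈ X → s β γ ∈Φ₊)

Res : List Root → Root → Set
Res X = Res (λ γ → InSpan X γ × γ ∈Φ₊) on X

Res^ : ℕ → List Root → Root → Set
Res^ i X γ = Res X γ × U i γ

Ξ : List Root → Root → Set
Ξ H γ = InSpan H γ × γ ∈Φ

Orth : Root → Root → Set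
Orth a b = B a b ≡ + 0

-- Root system of type D_k: the vectors of ℤᵏ of squared length 2
-- (i.e. ±eᵢ ± eⱼ, i ≠ j) with the standard inner product.

dot : {k : ℕ} → Vec ℤ k → Vec ℤ k → ℤ
dot u v = Vec.foldr _ _+_ (+ 0) (Vec.zipWith _*_ u v)

DRoot : ℕ → Set
DRoot k = Σ (Vec ℤ k) λ v → dot v v ≡ + 2

-- A set P ⊆ Φ (given as a predicate) is a root system of type D_k:
-- there is a bijection between P and the D_k roots preserving the
-- bilinear forms (an isomorphism of root systems).
record IsTypeD (k : ℕ) (P : Root → Set) : Set where
  field
    to       : (γ : Root) → P γ → DRoot k
    from     : DRoot k → Root
    from-in  : (v : DRoot k) → P (from v)
    to-from  : (v : DRoot k) → proj₁ (to (from v) (from-in v)) ≡ proj₁ v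
    from-to  : (γ : Root) (p : P γ) → from (to γ p) ≡ γ
    preserve : (γ δ : Root) (p : P γ) (q : P δ) →
               dot (proj₁ (to γ p)) (proj₁ (to δ q)) ≡ B γ δ

_⊆_ : List Root → List Root → Set
H ⊆ R = ∀ γ → γ ∈ H → γ ∈ R

-- H ∈ D_k(R): H ⊆ R, |H| = k (H duplicate-free of length k), and
-- Span(H) ∩ Φ is a subsystem of type D_k.
InD : ℕ → List Root → List Root → Set
InD k R H = H ⊆ R × Unique H × length H ≡ k × IsTypeD k (Ξ H)

U? : (i : ℕ) → Decidable (U i)
U? i γ = (γ ∈? positiveRoots) ×-dec (height8 γ ℤ.≟ + i)
  where open import Data.List.Membership.DecPropositional _≟R_ using (_∈?_)

card∩U : ℕ → List Root → ℕ
card∩U i H = length (filter (U? i) H)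

{-# OPTIONS --safe #-}
-- The form B is positive definite, so for pairwise orthogonal roots X and a root x Bessel's
-- inequality Σ_{β∈X} B(β,x)² ≤ 4 holds, with equality exactly when 2x = Σ_{β∈X} B(β,x) β; and
-- when x ∈ Span X this expansion always holds, giving 2 B(w,x) = Σ_{β∈X} B(β,x) B(w,β) for all w.
-- Summing the Bessel sums of R over an orthogonal frame of eight roots containing θ gives 4·|R| = 32,
-- so all of them are tight: θ ∈ Span R. Since B(θ,·) is the 8-height, θ is the only root of
-- 8-height 2 and s_β θ = θ - height(β) β, which yields (i). For γ ∈ Span H the expansion gives
-- 4 = Σ_{h∈H} B(h,γ)² and 2 height(γ) = Σ_{h∈H} B(h,γ) height(h). For γ = θ the first sum counts
-- H ∩ U₁, giving (iii); for γ ∈ Res⁰(H) each h contributes at most [h ∈ U₀] to the sum of the two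
-- (B(h,γ) ∈ {-1,0,1}, and B(h,γ) = 1 with h ∈ U₁ would make s_h γ negative), giving (ii).
module Submission where

open import Defs
open import Data.Nat using (ℕ; _<_)
open import Data.List using (List; length)
open import Data.List.Membership.Propositional using (_∉_)
open import Data.List.Relation.Unary.All using (All)
open import Data.List.Relation.Unary.AllPairs using (AllPairs)
open import Data.Product using (_×_)
open import Data.Sum using (_⊎_)
open import Relation.Binary.PropositionalEquality using (_≡_)
open import Relation.Nullary using (¬_)
open import Function.Bundles using (_⇔_)

import Data.Nat as ℕ
import Data.Nat.Properties as ℕP
open import Data.Bool using (true; false; if_then_else_)
open import Data.Fin using (Fin; zero; suc; #_)
import Data.Fin.Properties as Finₚ
open import Data.Vec as Vec using (Vec; []; _∷_)
import Data.Vec.Properties as Vecₚ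
open import Data.List using ([]; _∷_; lookup; filter)
open import Data.List.Membership.Propositional using (_∈_)
open import Data.List.Membership.Propositional.Properties using (∈-lookup)
open import Data.List.Membership.DecPropositional _≟R_ using (_∈?_)
import Data.List.Relation.Unary.All as All
open import Data.List.Relation.Unary.All using ([]; _∷_)
open import Data.List.Relation.Unary.AllPairs using ([]; _∷_)
open import Data.List.Relation.Unary.Any using (here; there)
open import Data.List.Relation.Unary.Unique.Propositional using (Unique)
open import Data.Integer as ℤ using (ℤ; +_; +[1+_]; -[1+_]; _+_; _-_; _*_; -_; _≤_)
import Data.Integer.Properties as ℤP
open import Data.Integer.Tactic.RingSolver using (solve-∀)
open import Algebra.Properties.CommutativeSemigroup ℤP.+-commutativeSemigroup using (interchange)
open import Algebra.Properties.Semiring.Sum ℤP.+-*-semiring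
  using (sum; sum-syntax; sum-cong-≗; ∑-comm; ∑-distrib-+; *-distribˡ-sum)
open import Data.Product using (_,_; proj₁; proj₂)
open import Data.Sum using (inj₁; inj₂; [_,_])
open import Data.Empty using (⊥-elim)
open import Function using (_∘_)
open import Function.Bundles using (mk⇔)
open import Relation.Binary.PropositionalEquality using (_≢_; refl; sym; trans; cong; cong₂; subst; module ≡-Reasoning)
open import Relation.Nullary using (does)
open import Relation.Nullary.Decidable using (True; toWitness; from-yes; dec-true; dec-false; _⊎-dec_; ¬?)
open import Relation.Unary using (Decidable)

dot-+ʳ : ∀ {n} (w u v : Vec ℤ n) → dot w (Vec.zipWith _+_ u v) ≡ dot w u + dot w v
dot-+ʳ [] [] [] = refl
dot-+ʳ (x ∷ w) (y ∷ u) (z ∷ v) = begin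
  x * (y + z) + dot w (Vec.zipWith _+_ u v) ≡⟨ cong₂ _+_ (ℤP.*-distribˡ-+ x y z) (dot-+ʳ w u v) ⟩
  x * y + x * z + (dot w u + dot w v)      ≡⟨ interchange (x * y) (x * z) (dot w u) (dot w v) ⟩
  x * y + dot w u + (x * z + dot w v)      ∎
  where open ≡-Reasoning

dot-−ʳ : ∀ {n} (w u v : Vec ℤ n) → dot w (Vec.zipWith _-_ u v) ≡ dot w u - dot w v
dot-−ʳ [] [] [] = refl
dot-−ʳ (x ∷ w) (y ∷ u) (z ∷ v) = trans (cong (_+_ (x * (y - z))) (dot-−ʳ w u v)) (distrib x y z (dot w u) (dot w v))
  where
  distrib : ∀ x y z p q → x * (y - z) + (p - q) ≡ x * y + p - (x * z + q)
  distrib = solve-∀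

dot-*ʳ : ∀ {n} k (w u : Vec ℤ n) → dot w (Vec.map (k *_) u) ≡ k * dot w u
dot-*ʳ k [] [] = sym (ℤP.*-zeroʳ k)
dot-*ʳ k (x ∷ w) (y ∷ u) = trans (cong (_+_ (x * (k * y))) (dot-*ʳ k w u)) (distrib k x y (dot w u))
  where
  distrib : ∀ k x y d → x * (k * y) + k * d ≡ k * (x * y + d)
  distrib = solve-∀

dot-zeroʳ : ∀ {n} (w : Vec ℤ n) → dot w (Vec.replicate n (+ 0)) ≡ + 0
dot-zeroʳ [] = refl
dot-zeroʳ (x ∷ w) = cong₂ _+_ (ℤP.*-zeroʳ x) (dot-zeroʳ w)

dot-zeroˡ : ∀ {n} (v : Vec ℤ n) → dot (Vec.replicate n (+ 0)) v ≡ + 0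
dot-zeroˡ [] = refl
dot-zeroˡ (x ∷ v) = cong₂ _+_ (ℤP.*-zeroˡ x) (dot-zeroˡ v)

basis : ∀ {n} → Fin n → Vec ℤ n
basis {ℕ.suc n} zero    = + 1 ∷ Vec.replicate n (+ 0)
basis           (suc i) = + 0 ∷ basis i

dot-basisˡ : ∀ {n} (i : Fin n) (v : Vec ℤ n) → dot (basis i) v ≡ Vec.lookup v i
dot-basisˡ zero    (x ∷ v) = trans (cong₂ _+_ (ℤP.*-identityˡ x) (dot-zeroˡ v)) (ℤP.+-identityʳ x)
dot-basisˡ (suc i) (x ∷ v) = trans (cong₂ _+_ (ℤP.*-zeroˡ x) (dot-basisˡ i v)) (ℤP.+-identityˡ _)

cartan : Root → Root
cartan (a1 ∷ a2 ∷ a3 ∷ a4 ∷ a5 ∷ a6 ∷ a7 ∷ a8 ∷ []) =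
  + 2 * a1 - a3 ∷ + 2 * a2 - a4 ∷ + 2 * a3 - a1 - a4 ∷ + 2 * a4 - a2 - a3 - a5 ∷
  + 2 * a5 - a4 - a6 ∷ + 2 * a6 - a5 - a7 ∷ + 2 * a7 - a6 - a8 ∷ + 2 * a8 - a7 ∷ []

-- The ring solver does not unfold definitions, so identities about B are proved on its
-- defining polynomial.
B≡dot-cartan : ∀ u v → B u v ≡ dot (cartan u) v
B≡dot-cartan (a1 ∷ a2 ∷ a3 ∷ a4 ∷ a5 ∷ a6 ∷ a7 ∷ a8 ∷ []) (b1 ∷ b2 ∷ b3 ∷ b4 ∷ b5 ∷ b6 ∷ b7 ∷ b8 ∷ []) =
  expanded a1 a2 a3 a4 a5 a6 a7 a8 b1 b2 b3 b4 b5 b6 b7 b8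
  where
  expanded : ∀ a1 a2 a3 a4 a5 a6 a7 a8 b1 b2 b3 b4 b5 b6 b7 b8 →
    + 2 * (a1 * b1 + a2 * b2 + a3 * b3 + a4 * b4 + a5 * b5 + a6 * b6 + a7 * b7 + a8 * b8)
      - (a1 * b3 + a3 * b1) - (a3 * b4 + a4 * b3) - (a4 * b5 + a5 * b4) - (a5 * b6 + a6 * b5)
      - (a6 * b7 + a7 * b6) - (a7 * b8 + a8 * b7) - (a2 * b4 + a4 * b2)
    ≡ (+ 2 * a1 - a3) * b1 + ((+ 2 * a2 - a4) * b2 + ((+ 2 * a3 - a1 - a4) * b3
      + ((+ 2 * a4 - a2 - a3 - a5) * b4 + ((+ 2 * a5 - a4 - a6) * b5 + ((+ 2 * a6 - a5 - a7) * b6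
      + ((+ 2 * a7 - a6 - a8) * b7 + ((+ 2 * a8 - a7) * b8 + + 0)))))))
  expanded = solve-∀

B-sym : ∀ u v → B u v ≡ B v u
B-sym (a1 ∷ a2 ∷ a3 ∷ a4 ∷ a5 ∷ a6 ∷ a7 ∷ a8 ∷ []) (b1 ∷ b2 ∷ b3 ∷ b4 ∷ b5 ∷ b6 ∷ b7 ∷ b8 ∷ []) =
  expanded a1 a2 a3 a4 a5 a6 a7 a8 b1 b2 b3 b4 b5 b6 b7 b8
  where
  expanded : ∀ a1 a2 a3 a4 a5 a6 a7 a8 b1 b2 b3 b4 b5 b6 b7 b8 →
    + 2 * (a1 * b1 + a2 * b2 + a3 * b3 + a4 * b4 + a5 * b5 + a6 * b6 + a7 * b7 + a8 * b8)
      - (a1 * b3 + a3 * b1) - (a3 * b4 + a4 * b3) - (a4 * b5 + a5 * b4) - (a5 * b6 + a6 * b5)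
      - (a6 * b7 + a7 * b6) - (a7 * b8 + a8 * b7) - (a2 * b4 + a4 * b2)
    ≡ + 2 * (b1 * a1 + b2 * a2 + b3 * a3 + b4 * a4 + b5 * a5 + b6 * a6 + b7 * a7 + b8 * a8)
      - (b1 * a3 + b3 * a1) - (b3 * a4 + b4 * a3) - (b4 * a5 + b5 * a4) - (b5 * a6 + b6 * a5)
      - (b6 * a7 + b7 * a6) - (b7 * a8 + b8 * a7) - (b2 * a4 + b4 * a2)
  expanded = solve-∀

B-+ʳ : ∀ w u v → B w (u +ᵥ v) ≡ B w u + B w v
B-+ʳ w u v = begin
  B w (u +ᵥ v)                          ≡⟨ B≡dot-cartan w (u +ᵥ v) ⟩
  dot (cartan w) (u +ᵥ v)               ≡⟨ dot-+ʳ (cartan w) u v ⟩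
  dot (cartan w) u + dot (cartan w) v   ≡⟨ sym (cong₂ _+_ (B≡dot-cartan w u) (B≡dot-cartan w v)) ⟩
  B w u + B w v                         ∎
  where open ≡-Reasoning

B-−ʳ : ∀ w u v → B w (u -ᵥ v) ≡ B w u - B w v
B-−ʳ w u v = begin
  B w (u -ᵥ v)                          ≡⟨ B≡dot-cartan w (u -ᵥ v) ⟩
  dot (cartan w) (u -ᵥ v)               ≡⟨ dot-−ʳ (cartan w) u v ⟩
  dot (cartan w) u - dot (cartan w) v   ≡⟨ sym (cong₂ _-_ (B≡dot-cartan w u) (B≡dot-cartan w v)) ⟩
  B w u - B w v                         ∎
  where open ≡-Reasoning

B-*ʳ : ∀ k w u → B w (k ·ᵥ u) ≡ k * B w u
B-*ʳ k w u = begin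
  B w (k ·ᵥ u)              ≡⟨ B≡dot-cartan w (k ·ᵥ u) ⟩
  dot (cartan w) (k ·ᵥ u)   ≡⟨ dot-*ʳ k (cartan w) u ⟩
  k * dot (cartan w) u      ≡⟨ cong (k *_) (sym (B≡dot-cartan w u)) ⟩
  k * B w u                 ∎
  where open ≡-Reasoning

B-zeroʳ : ∀ w → B w zeroᵥ ≡ + 0
B-zeroʳ w = trans (B≡dot-cartan w zeroᵥ) (dot-zeroʳ (cartan w))

B-−ˡ : ∀ u v w → B (u -ᵥ v) w ≡ B u w - B v w
B-−ˡ u v w = trans (B-sym (u -ᵥ v) w) (trans (B-−ʳ w u v) (cong₂ _-_ (B-sym w u) (B-sym w v)))

B-*ˡ : ∀ k u w → B (k ·ᵥ u) w ≡ k * B u w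
B-*ˡ k u w = trans (B-sym (k ·ᵥ u) w) (trans (B-*ʳ k w u) (cong (k *_) (B-sym w u)))

-- Positive definiteness

square-nonneg : ∀ x → + 0 ≤ x * x
square-nonneg (+ 0)     = ℤP.≤-refl
square-nonneg +[1+ n ]  = ℤ.+≤+ ℕ.z≤n
square-nonneg -[1+ n ]  = ℤ.+≤+ ℕ.z≤n

dot-self-nonneg : ∀ {n} (v : Vec ℤ n) → + 0 ≤ dot v v
dot-self-nonneg []      = ℤP.≤-refl
dot-self-nonneg (x ∷ v) = ℤP.+-mono-≤ (square-nonneg x) (dot-self-nonneg v)

-- Twice the coordinates of v in the standard model of E₈ in ℚ⁸, so 4 B v v is a sum of eight squares.
orthoCoords : Root → Vec ℤ 8
orthoCoords (a1 ∷ a2 ∷ a3 ∷ a4 ∷ a5 ∷ a6 ∷ a7 ∷ a8 ∷ []) =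
  a1 + + 2 * a2 - + 2 * a3 ∷ - a1 + + 2 * a2 + + 2 * a3 - + 2 * a4 ∷ - a1 + + 2 * a4 - + 2 * a5 ∷
  - a1 + + 2 * a5 - + 2 * a6 ∷ - a1 + + 2 * a6 - + 2 * a7 ∷ - a1 + + 2 * a7 - + 2 * a8 ∷
  - a1 + + 2 * a8 ∷ a1 ∷ []

4B≡dot-orthoCoords : ∀ v → + 4 * B v v ≡ dot (orthoCoords v) (orthoCoords v)
4B≡dot-orthoCoords (a1 ∷ a2 ∷ a3 ∷ a4 ∷ a5 ∷ a6 ∷ a7 ∷ a8 ∷ []) = expanded a1 a2 a3 a4 a5 a6 a7 a8
  where
  expanded : ∀ a1 a2 a3 a4 a5 a6 a7 a8 →
    let l1 = a1 + + 2 * a2 - + 2 * a3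
        l2 = - a1 + + 2 * a2 + + 2 * a3 - + 2 * a4
        l3 = - a1 + + 2 * a4 - + 2 * a5
        l4 = - a1 + + 2 * a5 - + 2 * a6
        l5 = - a1 + + 2 * a6 - + 2 * a7
        l6 = - a1 + + 2 * a7 - + 2 * a8
        l7 = - a1 + + 2 * a8
        l8 = a1
    in + 4 * (+ 2 * (a1 * a1 + a2 * a2 + a3 * a3 + a4 * a4 + a5 * a5 + a6 * a6 + a7 * a7 + a8 * a8)
         - (a1 * a3 + a3 * a1) - (a3 * a4 + a4 * a3) - (a4 * a5 + a5 * a4) - (a5 * a6 + a6 * a5)
         - (a6 * a7 + a7 * a6) - (a7 * a8 + a8 * a7) - (a2 * a4 + a4 * a2))
       ≡ l1 * l1 + (l2 * l2 + (l3 * l3 + (l4 * l4 + (l5 * l5 + (l6 * l6 + (l7 * l7 + (l8 * l8 + + 0)))))))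
  expanded = solve-∀

B-nonneg : ∀ v → + 0 ≤ B v v
B-nonneg v = ℤP.*-cancelˡ-≤-pos (+ 0) (B v v) (+ 4)
  (subst (+ 0 ≤_) (sym (4B≡dot-orthoCoords v)) (dot-self-nonneg (orthoCoords v)))

B-·ᵥ : ∀ s t u v → B (s ·ᵥ u) (t ·ᵥ v) ≡ s * (t * B u v)
B-·ᵥ s t u v = trans (B-*ˡ s u (t ·ᵥ v)) (cong (s *_) (B-*ʳ t u v))

B-norm-−ᵥ : ∀ u v {a b c} → B u u ≡ a → B u v ≡ b → B v v ≡ c → B (u -ᵥ v) (u -ᵥ v) ≡ a - + 2 * b + c
B-norm-−ᵥ u v refl refl refl = begin
  B (u -ᵥ v) (u -ᵥ v)                         ≡⟨ B-−ˡ u v (u -ᵥ v) ⟩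
  B u (u -ᵥ v) - B v (u -ᵥ v)                 ≡⟨ cong₂ _-_ (B-−ʳ u u v) (B-−ʳ v u v) ⟩
  (B u u - B u v) - (B v u - B v v)           ≡⟨ cong (λ x → (B u u - B u v) - (x - B v v)) (B-sym v u) ⟩
  (B u u - B u v) - (B u v - B v v)           ≡⟨ regroup (B u u) (B u v) (B v v) ⟩
  B u u - + 2 * B u v + B v v                 ∎
  where
  open ≡-Reasoning
  regroup : ∀ a b c → (a - b) - (b - c) ≡ a - + 2 * b + c
  regroup = solve-∀

-- Testing u = (c + 1) v - b w, where b = B v w and c = B w w, gives 0 ≤ B u u = - (c + 2) b².
B-isotropic⇒radical : ∀ v → B v v ≡ + 0 → ∀ w → B v w ≡ + 0
B-isotropic⇒radical v vv≡0 w = square≡0 (ℤP.≤-antisym b²≤0 (square-nonneg b))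
  where
  b = B v w
  c = B w w
  u = ((c + + 1) ·ᵥ v) -ᵥ (b ·ᵥ w)
  collect : ∀ b c → (c + + 1) * ((c + + 1) * + 0) - + 2 * ((c + + 1) * (b * b)) + b * (b * c)
                    ≡ - ((c + + 2) * (b * b))
  collect = solve-∀
  Buu : B u u ≡ - ((c + + 2) * (b * b))
  Buu = trans (B-norm-−ᵥ ((c + + 1) ·ᵥ v) (b ·ᵥ w)
                 (trans (B-·ᵥ (c + + 1) (c + + 1) v v) (cong (λ z → (c + + 1) * ((c + + 1) * z)) vv≡0))
                 (B-·ᵥ (c + + 1) b v w)
                 (B-·ᵥ b b w w))
              (collect b c)
  c+2>0 : + 0 ℤ.< c + + 2
  c+2>0 = ℤP.+-mono-≤-< (B-nonneg w) (ℤ.+<+ (ℕ.s≤s ℕ.z≤n))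
  b²≤0 : b * b ≤ + 0
  b²≤0 = ℤP.*-cancelˡ-≤-pos (b * b) (+ 0) (c + + 2) {{ℤ.positive c+2>0}}
    (subst ((c + + 2) * (b * b) ≤_) (sym (ℤP.*-zeroʳ (c + + 2)))
      (ℤP.neg-cancel-≤ (subst (+ 0 ≤_) Buu (B-nonneg u))))
  square≡0 : b * b ≡ + 0 → b ≡ + 0
  square≡0 b²≡0 = [ (λ p → p) , (λ p → p) ] (ℤP.i*j≡0⇒i≡0∨j≡0 b b²≡0)

-- The fundamental weights: the columns of the inverse Cartan matrix, which is integral for E₈.
ϖ : Fin 8 → Root
ϖ = Vec.lookup (r 4 5 7 10 8 6 4 2 ∷ r 5 8 10 15 12 9 6 3 ∷ r 7 10 14 20 16 12 8 4 ∷ r 10 15 20 30 24 18 12 6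
              ∷ r 8 12 16 24 20 15 10 5 ∷ r 6 9 12 18 15 12 8 4 ∷ r 4 6 8 12 10 8 6 3 ∷ r 2 3 4 6 5 4 3 2 ∷ [])

cartan-ϖ : ∀ i → cartan (ϖ i) ≡ basis i
cartan-ϖ = from-yes (Finₚ.all? (λ i → cartan (ϖ i) ≟R basis i))

B-ϖ : ∀ i v → B (ϖ i) v ≡ Vec.lookup v i
B-ϖ i v = begin
  B (ϖ i) v               ≡⟨ B≡dot-cartan (ϖ i) v ⟩
  dot (cartan (ϖ i)) v    ≡⟨ cong (λ x → dot x v) (cartan-ϖ i) ⟩
  dot (basis i) v         ≡⟨ dot-basisˡ i v ⟩
  Vec.lookup v i          ∎
  where open ≡-Reasoning

B-θ : ∀ v → B θ v ≡ height8 v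
B-θ v@(_ ∷ _ ∷ _ ∷ _ ∷ _ ∷ _ ∷ _ ∷ _ ∷ []) = B-ϖ (# 7) v

B-radical⇒zero : ∀ v → (∀ w → B v w ≡ + 0) → v ≡ zeroᵥ
B-radical⇒zero v radical = begin
  v                           ≡⟨ sym (Vecₚ.tabulate∘lookup v) ⟩
  Vec.tabulate (Vec.lookup v) ≡⟨ Vecₚ.tabulate-cong coordinate≡0 ⟩
  zeroᵥ                       ∎
  where
  open ≡-Reasoning
  coordinate≡0 : ∀ i → Vec.lookup v i ≡ + 0
  coordinate≡0 i = trans (sym (B-ϖ i v)) (trans (B-sym (ϖ i) v) (radical (ϖ i)))

B-definite : ∀ v → B v v ≡ + 0 → v ≡ zeroᵥ
B-definite v vv≡0 = B-radical⇒zero v (B-isotropic⇒radical v vv≡0)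

-- Orthogonal systems and Bessel's inequality

Norm2 : Root → Set
Norm2 v = B v v ≡ + 2

OrthogonalSystem : List Root → Set
OrthogonalSystem X = AllPairs Orth X × All Norm2 X

AllPairs-⊆ : ∀ {Rel : Root → Root → Set} {R H} → (∀ {x y} → Rel x y → Rel y x) →
             AllPairs Rel R → Unique H → H ⊆ R → AllPairs Rel H
AllPairs-⊆ {Rel} {R} sym-Rel pairsR = go
  where
  distinct⇒Rel : ∀ {R′} → AllPairs Rel R′ → ∀ {x y} → x ∈ R′ → y ∈ R′ → x ≢ y → Rel x y
  distinct⇒Rel (_ ∷ _)      (here refl) (here refl) x≢y = ⊥-elim (x≢y refl)
  distinct⇒Rel (xR ∷ _)     (here refl) (there y∈) _   = All.lookup xR y∈
  distinct⇒Rel (yR ∷ _)     (there x∈)  (here refl) _   = sym-Rel (All.lookup yR x∈)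
  distinct⇒Rel (_ ∷ pairs)  (there x∈)  (there y∈) x≢y = distinct⇒Rel pairs x∈ y∈ x≢y
  go : ∀ {H} → Unique H → H ⊆ R → AllPairs Rel H
  go []               _   = []
  go (h≢H ∷ uniqueH) H⊆R =
    All.tabulate (λ {y} y∈H → distinct⇒Rel pairsR (H⊆R _ (here refl)) (H⊆R y (there y∈H)) (All.lookup h≢H y∈H))
    ∷ go uniqueH (λ y y∈H → H⊆R y (there y∈H))

coords : (X : List Root) → Root → Fin (length X) → ℤ
coords X x i = B (lookup X i) x

coordSquares : List Root → Root → ℤ
coordSquares X x = ∑[ i < length X ] (coords X x i * coords X x i)

B-linComb : ∀ w X c → B w (linComb X c) ≡ ∑[ i < length X ] (c i * B w (lookup X i))
B-linComb w []      c = B-zeroʳ w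
B-linComb w (x ∷ X) c =
  trans (B-+ʳ w (c zero ·ᵥ x) (linComb X (c ∘ suc))) (cong₂ _+_ (B-*ʳ (c zero) w x) (B-linComb w X (c ∘ suc)))

B-linComb-orth : ∀ w X c → All (Orth w) X → B w (linComb X c) ≡ + 0
B-linComb-orth w []      c []         = B-zeroʳ w
B-linComb-orth w (x ∷ X) c (wx ∷ wX) = begin
  B w ((c zero ·ᵥ x) +ᵥ linComb X (c ∘ suc))     ≡⟨ B-+ʳ w (c zero ·ᵥ x) (linComb X (c ∘ suc)) ⟩
  B w (c zero ·ᵥ x) + B w (linComb X (c ∘ suc)) ≡⟨ cong₂ _+_ (trans (B-*ʳ (c zero) w x) (cong (c zero *_) wx))
                                                               (B-linComb-orth w X (c ∘ suc) wX) ⟩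
  c zero * + 0 + + 0                             ≡⟨ cong (_+ + 0) (ℤP.*-zeroʳ (c zero)) ⟩
  + 0                                            ∎
  where open ≡-Reasoning

B-lookup-linComb : ∀ {X} → OrthogonalSystem X → ∀ c j → B (lookup X j) (linComb X c) ≡ + 2 * c j
B-lookup-linComb {x ∷ X} (xX ∷ _ , xx ∷ _) c zero = begin
  B x ((c zero ·ᵥ x) +ᵥ linComb X (c ∘ suc))     ≡⟨ B-+ʳ x (c zero ·ᵥ x) (linComb X (c ∘ suc)) ⟩
  B x (c zero ·ᵥ x) + B x (linComb X (c ∘ suc)) ≡⟨ cong₂ _+_ (trans (B-*ʳ (c zero) x x) (cong (c zero *_) xx))
                                                               (B-linComb-orth x X (c ∘ suc) xX) ⟩
  c zero * + 2 + + 0                             ≡⟨ trans (ℤP.+-identityʳ _) (ℤP.*-comm (c zero) (+ 2)) ⟩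
  + 2 * c zero                                   ∎
  where open ≡-Reasoning
B-lookup-linComb {x ∷ X} (xX ∷ orth , _ ∷ norms) c (suc j) = begin
  B y ((c zero ·ᵥ x) +ᵥ linComb X (c ∘ suc))     ≡⟨ B-+ʳ y (c zero ·ᵥ x) (linComb X (c ∘ suc)) ⟩
  B y (c zero ·ᵥ x) + B y (linComb X (c ∘ suc)) ≡⟨ cong₂ _+_ (trans (B-*ʳ (c zero) y x) (cong (c zero *_) yx))
                                                               (B-lookup-linComb (orth , norms) (c ∘ suc) j) ⟩
  c zero * + 0 + + 2 * c (suc j)                 ≡⟨ trans (cong (_+ + 2 * c (suc j)) (ℤP.*-zeroʳ (c zero))) (ℤP.+-identityˡ _) ⟩
  + 2 * c (suc j)                                ∎
  where
  open ≡-Reasoning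
  y = lookup X j
  yx : B y x ≡ + 0
  yx = trans (B-sym y x) (All.lookup xX (∈-lookup j))

-- Pairing n γ = Σ cᵢ Xᵢ with Xᵢ gives n B(Xᵢ,γ) = 2 cᵢ; substitute this and cancel n.
span-expansion : ∀ {X γ} → OrthogonalSystem X → InSpan X γ →
                 ∀ w → + 2 * B w γ ≡ ∑[ i < length X ] (coords X γ i * B w (lookup X i))
span-expansion {X} {γ} sys (d , c , nγ≡lin) w = ℤP.*-cancelˡ-≡ n _ _ (begin
  n * (+ 2 * B w γ)                                          ≡⟨ swap n (+ 2) (B w γ) ⟩
  + 2 * (n * B w γ)                                          ≡⟨ cong (+ 2 *_) (sym (B-*ʳ n w γ)) ⟩
  + 2 * B w (n ·ᵥ γ)                                         ≡⟨ cong (λ v → + 2 * B w v) nγ≡lin ⟩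
  + 2 * B w (linComb X c)                                    ≡⟨ cong (+ 2 *_) (B-linComb w X c) ⟩
  + 2 * ∑[ i < length X ] (c i * B w (lookup X i))           ≡⟨ *-distribˡ-sum (+ 2) (λ i → c i * B w (lookup X i)) ⟩
  ∑[ i < length X ] (+ 2 * (c i * B w (lookup X i)))         ≡⟨ sum-cong-≗ term ⟩
  ∑[ i < length X ] (n * (coords X γ i * B w (lookup X i)))  ≡⟨ sym (*-distribˡ-sum n (λ i → coords X γ i * B w (lookup X i))) ⟩
  n * ∑[ i < length X ] (coords X γ i * B w (lookup X i))    ∎)
  where
  open ≡-Reasoning
  n = + ℕ.suc d
  swap : ∀ n a b → n * (a * b) ≡ a * (n * b)
  swap = solve-∀
  term : ∀ i → + 2 * (c i * B w (lookup X i)) ≡ n * (coords X γ i * B w (lookup X i))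
  term i = begin
    + 2 * (c i * B w (lookup X i))                  ≡⟨ sym (ℤP.*-assoc (+ 2) (c i) (B w (lookup X i))) ⟩
    + 2 * c i * B w (lookup X i)                    ≡⟨ cong (_* B w (lookup X i)) (sym (B-lookup-linComb sys c i)) ⟩
    B (lookup X i) (linComb X c) * B w (lookup X i) ≡⟨ cong (λ v → B (lookup X i) v * B w (lookup X i)) (sym nγ≡lin) ⟩
    B (lookup X i) (n ·ᵥ γ) * B w (lookup X i)      ≡⟨ cong (_* B w (lookup X i)) (B-*ʳ n (lookup X i) γ) ⟩
    n * coords X γ i * B w (lookup X i)             ≡⟨ ℤP.*-assoc n (coords X γ i) (B w (lookup X i)) ⟩
    n * (coords X γ i * B w (lookup X i))           ∎

residual : List Root → Root → Root
residual X x = ((+ 2) ·ᵥ x) -ᵥ linComb X (coords X x)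

B-residual : ∀ {X x} → OrthogonalSystem X → Norm2 x →
             B (residual X x) (residual X x) ≡ + 2 * (+ 4 - coordSquares X x)
B-residual {X} {x} sys xx = trans (B-norm-−ᵥ ((+ 2) ·ᵥ x) P B2x2x B2xP BPP) (collect q)
  where
  P = linComb X (coords X x)
  q = coordSquares X x
  collect : ∀ q → + 2 * (+ 2 * + 2) - + 2 * (+ 2 * q) + + 2 * q ≡ + 2 * (+ 4 - q)
  collect = solve-∀
  BxP : B x P ≡ q
  BxP = trans (B-linComb x X (coords X x))
              (sum-cong-≗ (λ i → cong (coords X x i *_) (B-sym x (lookup X i))))
  B2x2x : B ((+ 2) ·ᵥ x) ((+ 2) ·ᵥ x) ≡ + 2 * (+ 2 * + 2)
  B2x2x = trans (B-·ᵥ (+ 2) (+ 2) x x) (cong (λ z → + 2 * (+ 2 * z)) xx)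
  B2xP : B ((+ 2) ·ᵥ x) P ≡ + 2 * q
  B2xP = trans (B-*ˡ (+ 2) x P) (cong (λ z → + 2 * z) BxP)
  BPP : B P P ≡ + 2 * q
  BPP = begin
    B P P                                                    ≡⟨ B-linComb P X (coords X x) ⟩
    ∑[ i < length X ] (coords X x i * B P (lookup X i))      ≡⟨ sum-cong-≗ double ⟩
    ∑[ i < length X ] (+ 2 * (coords X x i * coords X x i))  ≡⟨ sym (*-distribˡ-sum (+ 2) (λ i → coords X x i * coords X x i)) ⟩
    + 2 * q                                                  ∎
    where
    open ≡-Reasoning
    rearrange : ∀ c → c * (+ 2 * c) ≡ + 2 * (c * c)
    rearrange = solve-∀
    double : ∀ i → coords X x i * B P (lookup X i) ≡ + 2 * (coords X x i * coords X x i)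
    double i = trans (cong (coords X x i *_) (trans (B-sym P (lookup X i)) (B-lookup-linComb sys (coords X x) i)))
                     (rearrange (coords X x i))

bessel : ∀ {X x} → OrthogonalSystem X → Norm2 x → coordSquares X x ≤ + 4
bessel {X} {x} sys xx = ℤP.0≤i-j⇒j≤i (ℤP.*-cancelˡ-≤-pos (+ 0) (+ 4 - coordSquares X x) (+ 2)
  (subst (+ 0 ≤_) (B-residual sys xx) (B-nonneg (residual X x))))

−ᵥ≡zero⇒≡ : ∀ {n} (u v : Vec ℤ n) → Vec.zipWith _-_ u v ≡ Vec.replicate n (+ 0) → u ≡ v
−ᵥ≡zero⇒≡ []      []      _  = refl
−ᵥ≡zero⇒≡ (x ∷ u) (y ∷ v) eq =
  cong₂ _∷_ (ℤP.i-j≡0⇒i≡j x y (cong Vec.head eq)) (−ᵥ≡zero⇒≡ u v (cong Vec.tail eq))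

bessel-equality : ∀ {X x} → OrthogonalSystem X → Norm2 x → coordSquares X x ≡ + 4 →
                  (+ 2) ·ᵥ x ≡ linComb X (coords X x)
bessel-equality {X} {x} sys xx q≡4 = −ᵥ≡zero⇒≡ _ _ (B-definite (residual X x) (begin
  B (residual X x) (residual X x)   ≡⟨ B-residual sys xx ⟩
  + 2 * (+ 4 - coordSquares X x)    ≡⟨ cong (λ q → + 2 * (+ 4 - q)) q≡4 ⟩
  + 0                               ∎))
  where open ≡-Reasoning

sum-mono-≤ : ∀ {n} {f g : Fin n → ℤ} → (∀ i → f i ≤ g i) → sum f ≤ sum g
sum-mono-≤ {ℕ.zero}  _   = ℤP.≤-refl
sum-mono-≤ {ℕ.suc n} f≤g = ℤP.+-mono-≤ (f≤g zero) (sum-mono-≤ (f≤g ∘ suc))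

+-tight : ∀ {a b c d} → a ≤ b → c ≤ d → a + c ≡ b + d → a ≡ b × c ≡ d
+-tight a≤b c≤d eq =
  ℤP.≤-antisym a≤b (ℤP.≮⇒≥ (λ a<b → ℤP.<-irrefl eq (ℤP.+-mono-<-≤ a<b c≤d))) ,
  ℤP.≤-antisym c≤d (ℤP.≮⇒≥ (λ c<d → ℤP.<-irrefl eq (ℤP.+-mono-≤-< a≤b c<d)))

sum-tight : ∀ {n} {f g : Fin n → ℤ} → (∀ i → f i ≤ g i) → sum f ≡ sum g → ∀ i → f i ≡ g i
sum-tight f≤g eq zero    = proj₁ (+-tight (f≤g zero) (sum-mono-≤ (f≤g ∘ suc)) eq)
sum-tight f≤g eq (suc i) = sum-tight (f≤g ∘ suc) (proj₂ (+-tight (f≤g zero) (sum-mono-≤ (f≤g ∘ suc)) eq)) i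

-- Double counting: summed over the frame the Bessel sums give 4 · |X|, so no Bessel inequality is strict.
frame-saturation : ∀ {m} (F : Fin m → Root) {X} → OrthogonalSystem X → (∀ j → Norm2 (F j)) → length X ≡ m →
                   All (λ β → ∑[ j < m ] (B β (F j) * B β (F j)) ≡ + 4) X →
                   ∀ j → coordSquares X (F j) ≡ + 4
frame-saturation {m} F {X} sys normF |X|≡m complete = sum-tight (λ j → bessel sys (normF j)) (begin
  ∑[ j < m ] ∑[ i < length X ] (B (lookup X i) (F j) * B (lookup X i) (F j))
    ≡⟨ ∑-comm (λ j i → B (lookup X i) (F j) * B (lookup X i) (F j)) ⟩
  ∑[ i < length X ] ∑[ j < m ] (B (lookup X i) (F j) * B (lookup X i) (F j))
    ≡⟨ sum-cong-≗ (λ i → All.lookup complete (∈-lookup i)) ⟩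
  ∑[ i < length X ] (+ 4)
    ≡⟨ cong (λ n → ∑[ i < n ] (+ 4)) |X|≡m ⟩
  ∑[ j < m ] (+ 4)  ∎)
  where open ≡-Reasoning

𝟙 : ∀ {P : Root → Set} → Decidable P → Root → ℤ
𝟙 P? x = if does (P? x) then + 1 else + 0

𝟙-yes : ∀ {P : Root → Set} (P? : Decidable P) {x} → P x → 𝟙 P? x ≡ + 1
𝟙-yes P? {x} p = cong (if_then + 1 else + 0) (dec-true (P? x) p)

𝟙-no : ∀ {P : Root → Set} (P? : Decidable P) {x} → ¬ P x → 𝟙 P? x ≡ + 0
𝟙-no P? {x} ¬p = cong (if_then + 1 else + 0) (dec-false (P? x) ¬p)

∑𝟙≡count : ∀ {P : Root → Set} (P? : Decidable P) X →
           ∑[ i < length X ] 𝟙 P? (lookup X i) ≡ + length (filter P? X)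
∑𝟙≡count P? []      = refl
∑𝟙≡count P? (x ∷ X) with does (P? x)
... | true  = cong (_+_ (+ 1)) (∑𝟙≡count P? X)
... | false = trans (ℤP.+-identityˡ _) (∑𝟙≡count P? X)

sum-≤-count : ∀ {P : Root → Set} (P? : Decidable P) X (f : Root → ℤ) → (∀ {x} → x ∈ X → f x ≤ 𝟙 P? x) →
              ∑[ i < length X ] f (lookup X i) ≤ + length (filter P? X)
sum-≤-count P? X f f≤𝟙 = subst (_ ≤_) (∑𝟙≡count P? X) (sum-mono-≤ (λ i → f≤𝟙 (∈-lookup i)))

-- Facts about the positive roots, checked by enumeration

Φ₊-by-enumeration : ∀ {P : Root → Set} (P? : Decidable P) → {True (All.all? P? positiveRoots)} →
                    ∀ {γ} → γ ∈Φ₊ → P γ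
Φ₊-by-enumeration P? {all} = All.lookup (toWitness all)

θ∈Φ₊ : θ ∈Φ₊
θ∈Φ₊ = from-yes (θ ∈? positiveRoots)

-- An orthogonal frame of roots containing θ. Being a basis, it satisfies Parseval's identity
-- Σ_f B(γ,f)² = 2 B(γ,γ) = 4 for every root γ; checking this root by root replaces a dimension argument.
frame : Fin 8 → Root
frame = Vec.lookup (θ ∷ r 0 0 0 0 0 0 1 0 ∷ r 0 0 0 0 1 0 0 0 ∷ r 0 0 1 0 0 0 0 0 ∷ r 0 1 0 0 0 0 0 0
                      ∷ r 0 1 1 2 1 0 0 0 ∷ r 0 1 1 2 2 2 1 0 ∷ r 2 2 3 4 3 2 1 0 ∷ [])

frame-norm : ∀ j → Norm2 (frame j)
frame-norm = from-yes (Finₚ.all? (λ j → B (frame j) (frame j) ℤ.≟ + 2))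

-- Kept abstract so that later conversion checks never re-run the enumerations.
abstract
  Φ₊-norm : ∀ {γ} → γ ∈Φ₊ → Norm2 γ
  Φ₊-norm = Φ₊-by-enumeration (λ γ → B γ γ ℤ.≟ + 2)

  s-self∉Φ₊ : ∀ {γ} → γ ∈Φ₊ → ¬ s γ γ ∈Φ₊
  s-self∉Φ₊ = Φ₊-by-enumeration (λ γ → ¬? (s γ γ ∈? positiveRoots))

  Φ₊-height : ∀ {γ} → γ ∈Φ₊ → γ ≡ θ ⊎ height8 γ ≡ + 0 ⊎ height8 γ ≡ + 1
  Φ₊-height = Φ₊-by-enumeration (λ γ → (γ ≟R θ) ⊎-dec (height8 γ ℤ.≟ + 0) ⊎-dec (height8 γ ℤ.≟ + 1))

  s-θ∈Φ₊ : ∀ {γ} → γ ∈Φ₊ → γ ≡ θ ⊎ s γ θ ∈Φ₊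
  s-θ∈Φ₊ = Φ₊-by-enumeration (λ γ → (γ ≟R θ) ⊎-dec (s γ θ ∈? positiveRoots))

  Φ₊-pairing : ∀ {γ δ} → γ ∈Φ₊ → δ ∈Φ₊ → γ ≡ δ ⊎ B γ δ ≡ -[1+ 0 ] ⊎ B γ δ ≡ + 0 ⊎ B γ δ ≡ + 1
  Φ₊-pairing γ∈ = All.lookup (Φ₊-by-enumeration
    (λ γ → All.all? (λ δ → (γ ≟R δ) ⊎-dec (B γ δ ℤ.≟ -[1+ 0 ]) ⊎-dec (B γ δ ℤ.≟ + 0) ⊎-dec (B γ δ ℤ.≟ + 1))
                    positiveRoots) γ∈)

  Φ₊-frame-complete : ∀ {γ} → γ ∈Φ₊ → ∑[ j < 8 ] (B γ (frame j) * B γ (frame j)) ≡ + 4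
  Φ₊-frame-complete = Φ₊-by-enumeration (λ γ → ∑[ j < 8 ] (B γ (frame j) * B γ (frame j)) ℤ.≟ + 4)

height8-s : ∀ β γ → height8 (s β γ) ≡ height8 γ - B β γ * height8 β
height8-s (_ ∷ _ ∷ _ ∷ _ ∷ _ ∷ _ ∷ _ ∷ _ ∷ []) (_ ∷ _ ∷ _ ∷ _ ∷ _ ∷ _ ∷ _ ∷ _ ∷ []) = refl

height8-nonneg : ∀ {γ} → γ ∈Φ₊ → + 0 ≤ height8 γ
height8-nonneg γ∈ with Φ₊-height γ∈
... | inj₁ refl        = ℤ.+≤+ ℕ.z≤n
... | inj₂ (inj₁ γ⁰)  = ℤP.≤-reflexive (sym γ⁰)
... | inj₂ (inj₂ γ¹)  = subst (+ 0 ≤_) (sym γ¹) (ℤ.+≤+ ℕ.z≤n)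

height0⇒¬height1 : ∀ {γ} → height8 γ ≡ + 0 → ¬ height8 γ ≡ + 1
height0⇒¬height1 γ⁰ γ¹ with () ← trans (sym γ⁰) γ¹

≢θ⇒height≤1 : ∀ {γ} → γ ∈Φ₊ → γ ≢ θ → height8 γ ≡ + 0 ⊎ height8 γ ≡ + 1
≢θ⇒height≤1 γ∈ γ≢θ with Φ₊-height γ∈
... | inj₁ γ≡θ = ⊥-elim (γ≢θ γ≡θ)
... | inj₂ ht  = ht

U²⇒θ : ∀ {γ} → U 2 γ → γ ≡ θ
U²⇒θ (γ∈ , γ²) with Φ₊-height γ∈
... | inj₁ γ≡θ        = γ≡θ
... | inj₂ (inj₁ γ⁰) with () ← trans (sym γ⁰) γ²
... | inj₂ (inj₂ γ¹) with () ← trans (sym γ¹) γ²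

pairing-bound⁰ : ∀ {b} → b ≡ -[1+ 0 ] ⊎ b ≡ + 0 ⊎ b ≡ + 1 → b * b + b * + 0 ≤ + 1
pairing-bound⁰ (inj₁ refl)        = ℤP.≤-refl
pairing-bound⁰ (inj₂ (inj₁ refl)) = ℤ.+≤+ ℕ.z≤n
pairing-bound⁰ (inj₂ (inj₂ refl)) = ℤP.≤-refl

pairing-bound¹ : ∀ {b} → b ≡ -[1+ 0 ] ⊎ b ≡ + 0 → b * b + b * + 1 ≤ + 0
pairing-bound¹ (inj₁ refl) = ℤP.≤-refl
pairing-bound¹ (inj₂ refl) = ℤP.≤-refl

module _ {h γ} (h∈ : h ∈Φ₊) (h≢θ : h ≢ θ) (γ∈ : γ ∈Φ₊) (γ⁰ : height8 γ ≡ + 0) (sγ∈ : s h γ ∈Φ₊) where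
  open ℤP.≤-Reasoning

  private
    pairing : B h γ ≡ -[1+ 0 ] ⊎ B h γ ≡ + 0 ⊎ B h γ ≡ + 1
    pairing with Φ₊-pairing h∈ γ∈
    ... | inj₁ refl = ⊥-elim (s-self∉Φ₊ h∈ sγ∈)
    ... | inj₂ b    = b

    -- Reflecting γ (of height 0) in h (of height 1) would otherwise produce height -1.
    pairing-height1 : height8 h ≡ + 1 → B h γ ≡ -[1+ 0 ] ⊎ B h γ ≡ + 0
    pairing-height1 h¹ with pairing
    ... | inj₁ b        = inj₁ b
    ... | inj₂ (inj₁ b) = inj₂ b
    ... | inj₂ (inj₂ b) = ⊥-elim (0≰-1 (subst (+ 0 ≤_) lowered (height8-nonneg sγ∈)))
      where
      0≰-1 : ¬ (+ 0 ≤ -[1+ 0 ])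
      0≰-1 ()
      lowered : height8 (s h γ) ≡ -[1+ 0 ]
      lowered = trans (height8-s h γ) (cong₂ _-_ γ⁰ (cong₂ _*_ b h¹))

  Res⁰-term≤𝟙 : B h γ * B γ h + B h γ * B θ h ≤ 𝟙 (U? 0) h
  Res⁰-term≤𝟙 with ≢θ⇒height≤1 h∈ h≢θ
  ... | inj₁ h⁰ = begin
    B h γ * B γ h + B h γ * B θ h ≡⟨ cong₂ (λ x y → B h γ * x + B h γ * y) (B-sym γ h) (trans (B-θ h) h⁰) ⟩
    B h γ * B h γ + B h γ * + 0   ≤⟨ pairing-bound⁰ pairing ⟩
    + 1                           ≡⟨ 𝟙-yes (U? 0) {h} (h∈ , h⁰) ⟨
    𝟙 (U? 0) h                    ∎
  ... | inj₂ h¹ = begin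
    B h γ * B γ h + B h γ * B θ h ≡⟨ cong₂ (λ x y → B h γ * x + B h γ * y) (B-sym γ h) (trans (B-θ h) h¹) ⟩
    B h γ * B h γ + B h γ * + 1   ≤⟨ pairing-bound¹ (pairing-height1 h¹) ⟩
    + 0                           ≡⟨ 𝟙-no (U? 0) {h} (λ (_ , h⁰) → height0⇒¬height1 {h} h⁰ h¹) ⟨
    𝟙 (U? 0) h                    ∎

θ-term≤𝟙 : ∀ {h} → h ∈Φ₊ → h ≢ θ → B h θ * B θ h ≤ 𝟙 (U? 1) h
θ-term≤𝟙 {h} h∈ h≢θ with ≢θ⇒height≤1 h∈ h≢θ
... | inj₁ h⁰ = begin
  B h θ * B θ h    ≡⟨ cong₂ _*_ (trans (B-sym h θ) (trans (B-θ h) h⁰)) (trans (B-θ h) h⁰) ⟩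
  + 0              ≡⟨ 𝟙-no (U? 1) {h} (height0⇒¬height1 {h} h⁰ ∘ proj₂) ⟨
  𝟙 (U? 1) h       ∎
  where open ℤP.≤-Reasoning
... | inj₂ h¹ = begin
  B h θ * B θ h    ≡⟨ cong₂ _*_ (trans (B-sym h θ) (trans (B-θ h) h¹)) (trans (B-θ h) h¹) ⟩
  + 1              ≡⟨ 𝟙-yes (U? 1) {h} (h∈ , h¹) ⟨
  𝟙 (U? 1) h       ∎
  where open ℤP.≤-Reasoning

4≤⇒≮4 : ∀ {n} → + 4 ≤ + n → ¬ n < 4
4≤⇒≮4 4≤n n<4 = ℕP.<⇒≱ n<4 (ℤP.drop‿+≤+ 4≤n)

module _ {H} (sys : OrthogonalSystem H) (H⊆Φ₊ : All _∈Φ₊ H) (θ∉H : θ ∉ H) where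
  open ℤP.≤-Reasoning

  private
    ≢θ : ∀ {h} → h ∈ H → h ≢ θ
    ≢θ h∈H refl = θ∉H h∈H

  Res⁰-empty : card∩U 0 H < 4 → ∀ γ → ¬ Res^ 0 H γ
  Res⁰-empty few γ (((γ∈span , γ∈) , reflections) , _ , γ⁰) = 4≤⇒≮4 (begin
    + 4                                            ≡⟨ cong₂ (λ x y → + 2 * x + + 2 * y) (Φ₊-norm γ∈) (trans (B-θ γ) γ⁰) ⟨
    + 2 * B γ γ + + 2 * B θ γ                      ≡⟨ cong₂ _+_ (span-expansion sys γ∈span γ) (span-expansion sys γ∈span θ) ⟩
    ∑[ i < length H ] f i + ∑[ i < length H ] g i  ≡⟨ ∑-distrib-+ f g ⟨
    ∑[ i < length H ] (f i + g i)                  ≤⟨ sum-≤-count (U? 0) H term term≤𝟙 ⟩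
    + card∩U 0 H                                   ∎) few
    where
    f g : Fin (length H) → ℤ
    f i = coords H γ i * B γ (lookup H i)
    g i = coords H γ i * B θ (lookup H i)
    term : Root → ℤ
    term h = B h γ * B γ h + B h γ * B θ h
    term≤𝟙 : ∀ {h} → h ∈ H → term h ≤ 𝟙 (U? 0) h
    term≤𝟙 h∈H = Res⁰-term≤𝟙 (All.lookup H⊆Φ₊ h∈H) (≢θ h∈H) γ∈ γ⁰ (reflections _ h∈H)

  θ∉Span : card∩U 1 H < 4 → ¬ InSpan H θ
  θ∉Span few θ∈span = 4≤⇒≮4 (begin
    + 2 * B θ θ                                               ≡⟨ span-expansion sys θ∈span θ ⟩
    ∑[ i < length H ] (coords H θ i * B θ (lookup H i))       ≤⟨ sum-≤-count (U? 1) H (λ h → B h θ * B θ h) term≤𝟙 ⟩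
    + card∩U 1 H                                              ∎) few
    where
    term≤𝟙 : ∀ {h} → h ∈ H → B h θ * B θ h ≤ 𝟙 (U? 1) h
    term≤𝟙 h∈H = θ-term≤𝟙 (All.lookup H⊆Φ₊ h∈H) (≢θ h∈H)

θ∈Span : ∀ {R} → length R ≡ 8 → All _∈Φ₊ R → AllPairs Orth R → InSpan R θ
θ∈Span {R} |R|≡8 R⊆Φ₊ orthR = 1 , coords R θ , bessel-equality sys refl
  (frame-saturation frame sys frame-norm |R|≡8 (All.map Φ₊-frame-complete R⊆Φ₊) zero)
  where
  sys = orthR , All.map Φ₊-norm R⊆Φ₊

lemma5p2 : (R : List Root) → length R ≡ 8 → All _∈Φ₊ R → AllPairs Orth R → θ ∉ R →
           (k : ℕ) → (k ≡ 4 ⊎ k ≡ 6) → (H : List Root) → InD k R H →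
           -- (i)
           ((∀ γ → Res^ 2 R γ ⇔ (γ ≡ θ)) × (Res _∈Φ₊ on H) θ)
           -- (ii)
           × (card∩U 0 H < 4 → ∀ γ → ¬ Res^ 0 H γ)
           -- (iii)
           × (card∩U 1 H < 4 → ¬ Ξ H θ × (∀ γ → ¬ Res^ 2 H γ))
lemma5p2 R |R|≡8 R⊆Φ₊ orthR θ∉R _ _ H (H⊆R , uniqueH , _) =
  (Res²R≡θ , θ∈Φ₊ , λ β β∈H → reflectR β (H⊆R β β∈H)) ,
  Res⁰-empty sysH H⊆Φ₊ θ∉H ,
  λ few → θ∉Span sysH H⊆Φ₊ θ∉H few ∘ proj₁ , Res²H-empty few
  where
  H⊆Φ₊ : All _∈Φ₊ H
  H⊆Φ₊ = All.tabulate (λ h∈H → All.lookup R⊆Φ₊ (H⊆R _ h∈H))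
  θ∉H : θ ∉ H
  θ∉H = θ∉R ∘ H⊆R θ
  sysH : OrthogonalSystem H
  sysH = AllPairs-⊆ (λ {x} {y} xy → trans (B-sym y x) xy) orthR uniqueH H⊆R , All.map Φ₊-norm H⊆Φ₊
  reflectR : ∀ β → β ∈ R → s β θ ∈Φ₊
  reflectR β β∈R with s-θ∈Φ₊ (All.lookup R⊆Φ₊ β∈R)
  ... | inj₁ refl = ⊥-elim (θ∉R β∈R)
  ... | inj₂ sθ∈  = sθ∈
  Res²R≡θ : ∀ γ → Res^ 2 R γ ⇔ (γ ≡ θ)
  Res²R≡θ γ = mk⇔ (U²⇒θ ∘ proj₂) λ { refl → ((θ∈Span |R|≡8 R⊆Φ₊ orthR , θ∈Φ₊) , reflectR) , θ∈Φ₊ , refl }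
  Res²H-empty : card∩U 1 H < 4 → ∀ γ → ¬ Res^ 2 H γ
  Res²H-empty few γ (((γ∈span , _) , _) , U²γ) = θ∉Span sysH H⊆Φ₊ θ∉H few (subst (InSpan H) (U²⇒θ U²γ) γ∈span)
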